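{- Let $f:\{0,1\}^n\to\{0,1\}$ be a monotone boolean function. Then $s(f)\le\deg_2(f)$.
   Context: $f$ is monotone if $f(x\vee y)\ge\max\{f(x),f(y)\}$ for all $x,y$ (bitwise OR). The sensitivity $s(f)$ is the maximum over $x\in\{0,1\}^n$ of the number of Hamming neighbours $y$ of $x$ with $f(y)\ne f(x)$. $\deg_2(f)$ is the degree of the unique multilinear polynomial over $\mathbb{F}_2$ representing $f$. -}

module Defs where

open import Data.Bool using (Bool; true; false; _∨_; _∧_; _xor_; not; if_then_else_)
open import Data.Bool.Base using (_≤_)
open import Data.Nat using (ℕ; zero; suc; _⊔_)
open import Data.Fin using (Fin)
open import Data.Vec using (Vec; []; _∷_; zipWith; lookup; updateAt; allFin; toList)
open import Data.List using (List; []; _∷_; map; _++_; foldr; concatMap; filter)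
open import Data.List.Relation.Unary.All using (All)
open import Relation.Binary.PropositionalEquality using (_≡_)

Cube : ℕ → Set
Cube n = Vec Bool n

allPoints : (n : ℕ) → List (Cube n)
allPoints zero = [] ∷ []
allPoints (suc n) = map (false ∷_) (allPoints n) ++ map (true ∷_) (allPoints n)

_∨ᵥ_ : {n : ℕ} → Cube n → Cube n → Cube n
_∨ᵥ_ = zipWith _∨_

Monotone : {n : ℕ} → (Cube n → Bool) → Set
Monotone {n} f = ∀ (x y : Cube n) → (f x ∨ f y) ≤ f (x ∨ᵥ y)

flipAt : {n : ℕ} → Fin n → Cube n → Cube n
flipAt i x = updateAt x i not

countTrue : List Bool → ℕ
countTrue = foldr (λ b k → if b then suc k else k) 0

maximum : List ℕ → ℕ
maximum = foldr _⊔_ 0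

sensitivityAt : {n : ℕ} → (Cube n → Bool) → Cube n → ℕ
sensitivityAt f x = countTrue (toList (Data.Vec.map (λ i → f (flipAt i x) xor f x) (allFin _)))

sensitivity : {n : ℕ} → (Cube n → Bool) → ℕ
sensitivity {n} f = maximum (map (sensitivityAt f) (allPoints n))

-- Multilinear polynomials over F₂ in n variables: a coefficient (in F₂ = Bool,
-- + = xor, · = ∧) for each monomial ∏_{i ∈ S} x_i, with S ⊆ [n] encoded as
-- its indicator vector in Cube n.
F2Poly : ℕ → Set
F2Poly n = Cube n → Bool

monomial : {n : ℕ} → Cube n → Cube n → Bool
monomial [] [] = true
monomial (s ∷ S) (x ∷ xs) = (if s then x else true) ∧ monomial S xs

eval : {n : ℕ} → F2Poly n → Cube n → Bool
eval {n} p x = foldr _xor_ false (map (λ S → p S ∧ monomial S x) (allPoints n))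

weight : {n : ℕ} → Cube n → ℕ
weight S = countTrue (toList S)

degree : {n : ℕ} → F2Poly n → ℕ
degree {n} p = maximum (map (λ S → if p S then weight S else 0) (allPoints n))

Represents : {n : ℕ} → F2Poly n → (Cube n → Bool) → Set
Represents p f = ∀ x → eval p x ≡ f x

-- Fix x and let D be the set of coordinates at which f is sensitive at x. For
-- monotone f every i ∈ D has xᵢ = f x, and consequently f equals ¬ f x on the
-- whole subcube through x spanned by D except at x itself. If D ≠ ∅ the subcube
-- has an even number 2^|D| of points, so the F₂-sum of f over it is 1. But the
-- F₂-sum of a monomial ∏_{i ∈ S} xᵢ over that subcube vanishes unless D ⊆ S,
-- so a representing polynomial must contain a monomial of degree at least |D|.
module Submission where

open import Defs
open import Data.Nat using (ℕ; _≤_)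
open import Data.Bool using (Bool)

open import Algebra.Bundles using (CommutativeMonoid; CommutativeRing)
open import Data.Bool.Base using (true; false; _∨_; _∧_; _xor_; not; if_then_else_)
import Data.Bool.Base as 𝔹
open import Data.Bool.Properties as 𝔹ₚ
  using (xor-assoc; xor-same; xor-∧-commutativeRing; ∧-conicalʳ; ∨-idem; ¬-not; not-¬; not-involutive)
open import Data.Fin.Base using (Fin; zero; suc)
open import Data.Fin.Properties using (¬∀⟶∃¬) renaming (_≟_ to _≟ᶠ_)
open import Data.Fin.Subset using (Subset; inside; outside; _∈_; _⊆_; ∣_∣; Nonempty)
open import Data.Fin.Subset.Properties
  using (in⊆in; out⊆; p⊆q⇒∣p∣≤∣q∣; nonempty?; Empty-unique; ∣⊥∣≡0)
open import Data.List.Base using (List; []; _∷_; map; _++_; foldr)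
open import Data.List.Properties using (map-++; map-∘; map-cong; map-cong-local)
open import Data.List.Relation.Unary.All as All using (All; []; _∷_)
open import Data.List.Relation.Unary.All.Properties using (++⁺; map⁺)
open import Data.List.Relation.Unary.Any as Any using (Any; here; there)
open import Data.List.Relation.Unary.Any.Properties using (map⁻)
open import Data.Nat.Base using (suc; z≤n)
open import Data.Nat.Properties using (≤-trans; m≤m⊔n; m≤n⊔m; ⊔-lub)
open import Data.Product.Base using (_,_)
open import Data.Sum using (_⊎_; inj₁; inj₂)
import Data.Sum as Sum
open import Data.Vec.Base using ([]; _∷_; lookup; allFin)
import Data.Vec.Base as Vec
open import Data.Vec.Properties
  using (≡-dec; lookup-map; lookup-allFin; []=⇒lookup; lookup∘updateAt; lookup∘updateAt′)
open import Data.Vec.Relation.Binary.Pointwise.Extensional using (ext; Pointwise-≡⇒≡)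
open import Function using (_∘_)
open import Relation.Binary.Definitions using (DecidableEquality)
open import Relation.Binary.PropositionalEquality
open import Relation.Nullary using (yes; no; does; contradiction)
open import Relation.Nullary.Decidable using (dec-true)

open import Algebra.Properties.CommutativeSemigroup
  (CommutativeMonoid.commutativeSemigroup (CommutativeRing.+-commutativeMonoid xor-∧-commutativeRing))
  using (interchange)

private
  variable
    n : ℕ
    A B : Set

parity : List Bool → Bool
parity = foldr _xor_ false

parity-++ : ∀ (u v : List Bool) → parity (u ++ v) ≡ parity u xor parity v
parity-++ []      v = refl
parity-++ (a ∷ u) v = trans (cong (a xor_) (parity-++ u v)) (sym (xor-assoc a (parity u) (parity v)))

parity-map-false : ∀ (L : List A) → parity (map (λ _ → false) L) ≡ false
parity-map-false []      = refl
parity-map-false (_ ∷ L) = parity-map-false L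

parity-map-∧ˡ : ∀ c (g : A → Bool) L → parity (map (λ a → c ∧ g a) L) ≡ c ∧ parity (map g L)
parity-map-∧ˡ true  g L = refl
parity-map-∧ˡ false g L = parity-map-false L

parity-map-xor : ∀ (g h : A → Bool) L →
                 parity (map (λ a → g a xor h a) L) ≡ parity (map g L) xor parity (map h L)
parity-map-xor g h []      = refl
parity-map-xor g h (a ∷ L) =
  trans (cong ((g a xor h a) xor_) (parity-map-xor g h L))
        (interchange (g a) (h a) (parity (map g L)) (parity (map h L)))

parity-swap : ∀ (G : A → B → Bool) (As : List A) (Bs : List B) →
              parity (map (λ b → parity (map (λ a → G a b) As)) Bs) ≡
              parity (map (λ a → parity (map (G a) Bs)) As)
parity-swap G As []       = sym (parity-map-false As)
parity-swap G As (b ∷ Bs) =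
  trans (cong (parity (map (λ a → G a b) As) xor_) (parity-swap G As Bs))
        (sym (parity-map-xor (λ a → G a b) (λ a → parity (map (G a) Bs)) As))

parity≡true⇒any : ∀ (L : List Bool) → parity L ≡ true → Any (_≡ true) L
parity≡true⇒any (true  ∷ L) _ = here refl
parity≡true⇒any (false ∷ L) e = there (parity≡true⇒any L e)

parity-map-∘ : ∀ (g : B → Bool) (h : A → B) L → parity (map g (map h L)) ≡ parity (map (g ∘ h) L)
parity-map-∘ g h L = cong parity (sym (map-∘ L))

≤-maximum : ∀ (h : A → ℕ) {k} {L : List A} → Any (λ a → k ≤ h a) L → k ≤ maximum (map h L)
≤-maximum h {L = a ∷ L} (here k≤ha) = ≤-trans k≤ha (m≤m⊔n (h a) _)
≤-maximum h {L = a ∷ L} (there k≤) = ≤-trans (≤-maximum h k≤) (m≤n⊔m (h a) _)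

maximum-≤ : ∀ (h : A → ℕ) {d} (L : List A) → (∀ a → h a ≤ d) → maximum (map h L) ≤ d
maximum-≤ h []      _ = z≤n
maximum-≤ h (a ∷ L) h≤d = ⊔-lub (h≤d a) (maximum-≤ h L h≤d)

weight≡∣∣ : ∀ (S : Subset n) → weight S ≡ ∣ S ∣
weight≡∣∣ []            = refl
weight≡∣∣ (inside ∷ S)  = cong suc (weight≡∣∣ S)
weight≡∣∣ (outside ∷ S) = weight≡∣∣ S

⊆⇒weight≤ : ∀ {D T : Subset n} → D ⊆ T → weight D ≤ weight T
⊆⇒weight≤ {D = D} {T} D⊆T =
  subst₂ _≤_ (sym (weight≡∣∣ D)) (sym (weight≡∣∣ T)) (p⊆q⇒∣p∣≤∣q∣ D⊆T)

subcube : Subset n → Cube n → List (Cube n)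
subcube []            []      = [] ∷ []
subcube (inside ∷ D)  (_ ∷ x) = map (false ∷_) (subcube D x) ++ map (true ∷_) (subcube D x)
subcube (outside ∷ D) (a ∷ x) = map (a ∷_) (subcube D x)

AgreeOutside : Subset n → Cube n → Cube n → Set
AgreeOutside D y x = ∀ j → j ∈ D ⊎ lookup y j ≡ lookup x j

subcube-agreeOutside : ∀ (D : Subset n) x → All (λ y → AgreeOutside D y x) (subcube D x)
subcube-agreeOutside []            []      = (λ ()) ∷ []
subcube-agreeOutside (inside ∷ D)  (a ∷ x) =
  ++⁺ (map⁺ (All.map cons (subcube-agreeOutside D x))) (map⁺ (All.map cons (subcube-agreeOutside D x)))
  where
  cons : ∀ {b y} → AgreeOutside D y x → AgreeOutside (inside ∷ D) (b ∷ y) (a ∷ x)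
  cons agree zero    = inj₁ Vec.here
  cons agree (suc j) = Sum.map₁ Vec.there (agree j)
subcube-agreeOutside (outside ∷ D) (a ∷ x) = map⁺ (All.map cons (subcube-agreeOutside D x))
  where
  cons : ∀ {y} → AgreeOutside D y x → AgreeOutside (outside ∷ D) (a ∷ y) (a ∷ x)
  cons agree zero    = inj₂ refl
  cons agree (suc j) = Sum.map₁ Vec.there (agree j)

parity-subcube-inside : ∀ (g : Cube (suc n) → Bool) D a x →
  parity (map g (subcube (inside ∷ D) (a ∷ x))) ≡
  parity (map (g ∘ (false ∷_)) (subcube D x)) xor parity (map (g ∘ (true ∷_)) (subcube D x))
parity-subcube-inside g D a x = begin
  parity (map g (map (false ∷_) C ++ map (true ∷_) C))
    ≡⟨ cong parity (map-++ g (map (false ∷_) C) (map (true ∷_) C)) ⟩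
  parity (map g (map (false ∷_) C) ++ map g (map (true ∷_) C))
    ≡⟨ parity-++ (map g (map (false ∷_) C)) (map g (map (true ∷_) C)) ⟩
  parity (map g (map (false ∷_) C)) xor parity (map g (map (true ∷_) C))
    ≡⟨ cong₂ _xor_ (parity-map-∘ g (false ∷_) C) (parity-map-∘ g (true ∷_) C) ⟩
  parity (map (g ∘ (false ∷_)) C) xor parity (map (g ∘ (true ∷_)) C) ∎
  where
  open ≡-Reasoning
  C = subcube D x

parity-subcube-outside : ∀ (g : Cube (suc n) → Bool) D a x →
  parity (map g (subcube (outside ∷ D) (a ∷ x))) ≡ parity (map (g ∘ (a ∷_)) (subcube D x))
parity-subcube-outside g D a x = parity-map-∘ g (a ∷_) (subcube D x)

parity-const-subcube : ∀ (D : Subset n) x c → Nonempty D → parity (map (λ _ → c) (subcube D x)) ≡ false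
parity-const-subcube (inside ∷ D)  (a ∷ x) c _ =
  trans (parity-subcube-inside (λ _ → c) D a x) (xor-same (parity (map (λ _ → c) (subcube D x))))
parity-const-subcube (outside ∷ D) (a ∷ x) c (suc i , Vec.there i∈D) =
  trans (parity-subcube-outside (λ _ → c) D a x) (parity-const-subcube D x c (i , i∈D))

parity-monomial-subcube⇒⊆ : ∀ (D T : Subset n) x → parity (map (monomial T) (subcube D x)) ≡ true → D ⊆ T
parity-monomial-subcube⇒⊆ []            []            []      _ ()
parity-monomial-subcube⇒⊆ (inside ∷ D)  (inside ∷ T)  (a ∷ x) e =
  in⊆in (parity-monomial-subcube⇒⊆ D T x
    (trans (sym (cong (_xor parity (map (monomial T) (subcube D x))) (parity-map-false (subcube D x))))
           (trans (sym (parity-subcube-inside (monomial (inside ∷ T)) D a x)) e)))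
parity-monomial-subcube⇒⊆ (inside ∷ D)  (outside ∷ T) (a ∷ x) e =
  contradiction (trans (sym (xor-same (parity (map (monomial T) (subcube D x)))))
                       (trans (sym (parity-subcube-inside (monomial (outside ∷ T)) D a x)) e))
                λ ()
parity-monomial-subcube⇒⊆ (outside ∷ D) (t ∷ T)       (a ∷ x) e =
  out⊆ (parity-monomial-subcube⇒⊆ D T x (∧-conicalʳ _ _
    (trans (sym (parity-map-∧ˡ (if t then a else true) (monomial T) (subcube D x)))
           (trans (sym (parity-subcube-outside (monomial (t ∷ T)) D a x)) e))))

_≟ᶜ_ : DecidableEquality (Cube n)
_≟ᶜ_ = ≡-dec 𝔹ₚ._≟_

parity-point-subcube : ∀ (D : Subset n) x → parity (map (λ y → does (y ≟ᶜ x)) (subcube D x)) ≡ true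
parity-point-subcube []            []          = refl
parity-point-subcube (outside ∷ D) (a ∷ x)     = begin
  parity (map (λ y → does (y ≟ᶜ (a ∷ x))) (subcube (outside ∷ D) (a ∷ x)))
    ≡⟨ parity-subcube-outside (λ y → does (y ≟ᶜ (a ∷ x))) D a x ⟩
  parity (map (λ y → does (a 𝔹ₚ.≟ a) ∧ does (y ≟ᶜ x)) (subcube D x))
    ≡⟨ parity-map-∧ˡ (does (a 𝔹ₚ.≟ a)) (λ y → does (y ≟ᶜ x)) (subcube D x) ⟩
  does (a 𝔹ₚ.≟ a) ∧ parity (map (λ y → does (y ≟ᶜ x)) (subcube D x))
    ≡⟨ cong₂ _∧_ (dec-true (a 𝔹ₚ.≟ a) refl) (parity-point-subcube D x) ⟩
  true ∎
  where open ≡-Reasoning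
parity-point-subcube (inside ∷ D)  (true ∷ x)  =
  trans (parity-subcube-inside (λ y → does (y ≟ᶜ (true ∷ x))) D true x)
        (cong₂ _xor_ (parity-map-false (subcube D x)) (parity-point-subcube D x))
parity-point-subcube (inside ∷ D)  (false ∷ x) =
  trans (parity-subcube-inside (λ y → does (y ≟ᶜ (false ∷ x))) D false x)
        (cong₂ _xor_ (parity-point-subcube D x) (parity-map-false (subcube D x)))

subcube-parity⇒weight≤degree : ∀ (p : F2Poly n) D x →
  parity (map (eval p) (subcube D x)) ≡ true → weight D ≤ degree p
subcube-parity⇒weight≤degree {n} p D x e =
  ≤-maximum (λ S → if p S then weight S else 0) (Any.map (λ {S} → weight≤ S) monomial-hit)
  where
  C = subcube D x
  coefficientParity : Cube n → Bool
  coefficientParity S = p S ∧ parity (map (monomial S) C)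
  sum≡true : parity (map coefficientParity (allPoints n)) ≡ true
  sum≡true = begin
    parity (map coefficientParity (allPoints n))
      ≡⟨ cong parity (map-cong (λ S → sym (parity-map-∧ˡ (p S) (monomial S) C)) (allPoints n)) ⟩
    parity (map (λ S → parity (map (λ y → p S ∧ monomial S y) C)) (allPoints n))
      ≡⟨ sym (parity-swap (λ S y → p S ∧ monomial S y) (allPoints n) C) ⟩
    parity (map (eval p) C)
      ≡⟨ e ⟩
    true ∎
    where open ≡-Reasoning
  monomial-hit : Any (λ S → coefficientParity S ≡ true) (allPoints n)
  monomial-hit = map⁻ (parity≡true⇒any _ sum≡true)
  weight≤ : ∀ S → coefficientParity S ≡ true → weight D ≤ (if p S then weight S else 0)
  weight≤ S hit with p S
  ... | true  = ⊆⇒weight≤ (parity-monomial-subcube⇒⊆ D S x hit)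
  ... | false = contradiction hit λ ()

pointwise-≤⇒∨ᵥ≡ : ∀ (y z : Cube n) → (∀ i → lookup y i 𝔹.≤ lookup z i) → y ∨ᵥ z ≡ z
pointwise-≤⇒∨ᵥ≡ []      []      _ = refl
pointwise-≤⇒∨ᵥ≡ (a ∷ y) (c ∷ z) y≤z =
  cong₂ _∷_ (≤⇒∨≡ (y≤z zero)) (pointwise-≤⇒∨ᵥ≡ y z (y≤z ∘ suc))
  where
  ≤⇒∨≡ : ∀ {a c} → a 𝔹.≤ c → a ∨ c ≡ c
  ≤⇒∨≡ 𝔹.f≤t = refl
  ≤⇒∨≡ 𝔹.b≤b = ∨-idem _

monotone-≤ : ∀ {f : Cube n → Bool} → Monotone f →
             ∀ {y z} → (∀ i → lookup y i 𝔹.≤ lookup z i) → f y 𝔹.≤ f z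
monotone-≤ {f = f} M {y} {z} y≤z =
  𝔹ₚ.≤-trans (≤-∨ (f y) (f z))
             (subst (λ w → f y ∨ f z 𝔹.≤ f w) (pointwise-≤⇒∨ᵥ≡ y z y≤z) (M y z))
  where
  ≤-∨ : ∀ a c → a 𝔹.≤ a ∨ c
  ≤-∨ false c = 𝔹ₚ.≤-minimum c
  ≤-∨ true  c = 𝔹.b≤b

monotone-push : ∀ {f : Cube n → Bool} → Monotone f → ∀ b {y z} →
                (∀ i → lookup z i ≡ lookup y i ⊎ lookup z i ≡ b) → f y ≡ b → f z ≡ b
monotone-push {f = f} M true  {y} {z} pushed fy≡b =
  𝔹ₚ.≤-antisym (𝔹ₚ.≤-maximum _) (subst (𝔹._≤ f z) fy≡b (monotone-≤ {f = f} M {y} {z} y≤z))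
  where
  y≤z : ∀ i → lookup y i 𝔹.≤ lookup z i
  y≤z i = Sum.[ (λ e → 𝔹ₚ.≤-reflexive (sym e))
              , (λ e → subst (_ 𝔹.≤_) (sym e) (𝔹ₚ.≤-maximum _)) ] (pushed i)
monotone-push {f = f} M false {y} {z} pushed fy≡b =
  𝔹ₚ.≤-antisym (subst (f z 𝔹.≤_) fy≡b (monotone-≤ {f = f} M {z} {y} z≤y)) (𝔹ₚ.≤-minimum _)
  where
  z≤y : ∀ i → lookup z i 𝔹.≤ lookup y i
  z≤y i = Sum.[ 𝔹ₚ.≤-reflexive , (λ e → subst (𝔹._≤ _) (sym e) (𝔹ₚ.≤-minimum _)) ] (pushed i)

sensitiveSet : (Cube n → Bool) → Cube n → Subset n
sensitiveSet f x = Vec.map (λ i → f (flipAt i x) xor f x) (allFin _)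

∈-sensitiveSet : ∀ (f : Cube n → Bool) x {i} → i ∈ sensitiveSet f x → f (flipAt i x) ≡ not (f x)
∈-sensitiveSet f x {i} i∈D = xor≡true (trans (sym lookup-sensitive) ([]=⇒lookup i∈D))
  where
  lookup-sensitive : lookup (sensitiveSet f x) i ≡ f (flipAt i x) xor f x
  lookup-sensitive = trans (lookup-map i _ (allFin _)) (cong (λ j → f (flipAt j x) xor f x) (lookup-allFin i))
  xor≡true : ∀ {a b} → a xor b ≡ true → a ≡ not b
  xor≡true {true}  {false} _ = refl
  xor≡true {false} {true}  _ = refl

lookup-flipAt-≢ : ∀ {i j : Fin n} (x : Cube n) → j ≢ i → lookup (flipAt i x) j ≡ lookup x j
lookup-flipAt-≢ {i = i} {j} x j≢i = lookup∘updateAt′ j i j≢i x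

module _ {f : Cube n → Bool} (M : Monotone f) (x : Cube n) where

  private
    D = sensitiveSet f x

  sensitive⇒lookup≡f : ∀ {i} → i ∈ D → lookup x i ≡ f x
  sensitive⇒lookup≡f {i} i∈D with lookup x i 𝔹ₚ.≟ f x
  ... | yes xᵢ≡fx = xᵢ≡fx
  ... | no  xᵢ≢fx = contradiction (∈-sensitiveSet f x i∈D) (not-¬ (monotone-push {f = f} M (f x) pushed refl))
    where
    pushed : ∀ k → lookup (flipAt i x) k ≡ lookup x k ⊎ lookup (flipAt i x) k ≡ f x
    pushed k with k ≟ᶠ i
    ... | yes refl = inj₂ (trans (lookup∘updateAt i x) (trans (cong not (¬-not xᵢ≢fx)) (not-involutive _)))
    ... | no  k≢i  = inj₁ (lookup-flipAt-≢ x k≢i)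

  -- Starting from flipAt i x for a sensitive i at which y differs from x, y is
  -- reached by pushing coordinates to ¬ f x, since xₖ = f x on all of D.
  off-point-constant : ∀ {y} → AgreeOutside D y x → y ≢ x → f y ≡ not (f x)
  off-point-constant {y} agree y≢x
    with ¬∀⟶∃¬ n _ (λ i → lookup y i 𝔹ₚ.≟ lookup x i) (y≢x ∘ Pointwise-≡⇒≡ ∘ ext)
  ... | i , yᵢ≢xᵢ with agree i
  ...   | inj₂ yᵢ≡xᵢ = contradiction yᵢ≡xᵢ yᵢ≢xᵢ
  ...   | inj₁ i∈D   = monotone-push {f = f} M (not (f x)) pushed (∈-sensitiveSet f x i∈D)
    where
    pushed : ∀ k → lookup y k ≡ lookup (flipAt i x) k ⊎ lookup y k ≡ not (f x)
    pushed k with k ≟ᶠ i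
    ... | yes refl = inj₁ (trans (¬-not yᵢ≢xᵢ) (sym (lookup∘updateAt i x)))
    ... | no  k≢i with agree k | lookup y k 𝔹ₚ.≟ f x
    ...   | inj₂ yₖ≡xₖ | _          = inj₁ (trans yₖ≡xₖ (sym (lookup-flipAt-≢ x k≢i)))
    ...   | inj₁ k∈D   | yes yₖ≡fx  =
            inj₁ (trans yₖ≡fx (trans (sym (sensitive⇒lookup≡f k∈D)) (sym (lookup-flipAt-≢ x k≢i))))
    ...   | inj₁ _     | no  yₖ≢fx  = inj₂ (¬-not yₖ≢fx)

  restriction-to-sensitive-subcube : ∀ {y} → AgreeOutside D y x → f y ≡ does (y ≟ᶜ x) xor not (f x)
  restriction-to-sensitive-subcube {y} agree with y ≟ᶜ x
  ... | yes refl = sym (not-involutive (f x))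
  ... | no  y≢x  = off-point-constant agree y≢x

  parity-sensitive-subcube : Nonempty D → parity (map f (subcube D x)) ≡ true
  parity-sensitive-subcube nonempty = begin
    parity (map f (subcube D x))
      ≡⟨ cong parity (map-cong-local (All.map restriction-to-sensitive-subcube (subcube-agreeOutside D x))) ⟩
    parity (map (λ y → does (y ≟ᶜ x) xor not (f x)) (subcube D x))
      ≡⟨ parity-map-xor (λ y → does (y ≟ᶜ x)) (λ _ → not (f x)) (subcube D x) ⟩
    parity (map (λ y → does (y ≟ᶜ x)) (subcube D x)) xor parity (map (λ _ → not (f x)) (subcube D x))
      ≡⟨ cong₂ _xor_ (parity-point-subcube D x) (parity-const-subcube D x (not (f x)) nonempty) ⟩
    true ∎
    where open ≡-Reasoning

  sensitivityAt≤degree : ∀ (p : F2Poly n) → Represents p f → sensitivityAt f x ≤ degree p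
  sensitivityAt≤degree p represents with nonempty? D
  ... | yes nonempty =
        subcube-parity⇒weight≤degree p D x
          (trans (cong parity (map-cong represents (subcube D x))) (parity-sensitive-subcube nonempty))
  ... | no  empty    =
        subst (_≤ degree p)
              (sym (trans (weight≡∣∣ D) (trans (cong ∣_∣ (Empty-unique empty)) (∣⊥∣≡0 n)))) z≤n

lemma3 : (n : ℕ) (f : Cube n → Bool) → Monotone f →
         (p : F2Poly n) → Represents p f → sensitivity f ≤ degree p
lemma3 n f M p represents =
  maximum-≤ (sensitivityAt f) (allPoints n) (λ x → sensitivityAt≤degree M x p represents)
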